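{- Let $I_4=\{1,2,3,4\}$, let $\varphi,\alpha\in S_{I_4}$, and let $\mathfrak{N}$ be a Veblen configuration defined on $\wp_2(I_4)$. Then $\mathbf{\Pi}(p,\bar\varphi\varkappa,\mathfrak{N})\cong\mathbf{\Pi}(p,\overline{\alpha\varphi\alpha^{ -1}}\varkappa,\bar\alpha(\mathfrak{N}))$.
   Context: $\wp_2(I_4)$ is the set of 2-element subsets of $I_4$ and $S_{I_4}$ the group of permutations of $I_4$. For $\psi\in S_{I_4}$, $\bar\psi$ is the induced bijection $\{i,j\}\mapsto\{\psi(i),\psi(j)\}$ of $\wp_2(I_4)$; $\varkappa(u)=I_4\setminus u$ for $u\in\wp_2(I_4)$. A Veblen configuration on $\wp_2(I_4)$ is a family of four 3-element subsets of $\wp_2(I_4)$ ("lines") such that every element of $\wp_2(I_4)$ lies on exactly two lines and any two lines meet in exactly one element; $\bar\alpha(\mathfrak{N})$ is the Veblen configuration with lines $\{\bar\alpha(u):u\in L\}$, $L$ a line of $\mathfrak{N}$. Take pairwise distinct symbols $p$, $a_i,b_i$ ($i\in I_4$), $c_u$ ($u\in\wp_2(I_4)$). For a bijection $\delta$ of $\wp_2(I_4)$, $\mathbf{\Pi}(p,\delta,\mathfrak{N})$ is the incidence structure with points $p,a_i,b_i,c_u$ and lines: $\{c_u:u\in L\}$ for each line $L$ of $\mathfrak{N}$; $\{a_i,a_j,c_{\{i,j\}}\}$ and $\{b_i,b_j,c_{\delta^{ -1}(\{i,j\})}\}$ for $\{i,j\}\in\wp_2(I_4)$; and $\{p,a_i,b_i\}$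 for $i\in I_4$. $\cong$ denotes isomorphism (a bijection of point sets mapping lines onto lines). -}

module Defs where

open import Data.Nat using (ℕ) renaming (suc to sucℕ)
open import Data.Bool using (Bool; true; false; T)
open import Data.Fin using (Fin; zero; suc)
open import Data.Fin.Permutation using (Permutation′; _⟨$⟩ʳ_; _⟨$⟩ˡ_; inverseˡ; flip; _∘ₚ_)
open import Data.List using (List; []; _∷_; filter; length)
open import Data.Product using (Σ; _×_; _,_)
open import Data.Sum using (_⊎_)
open import Data.Empty using (⊥-elim)
open import Relation.Nullary using (¬_)
open import Relation.Binary.PropositionalEquality using (_≡_; _≢_; refl; sym; trans; cong)
open import Function.Bundles using (_↔_; Inverse)
open import Data.Unit using (⊤)
open import Data.Empty using (⊥)
open import Data.Bool using (_∧_)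

-- I₄ is represented by Fin 4 (elements 0,1,2,3 stand for 1,2,3,4).

I₄ : Set
I₄ = Fin 4

pattern i0 = zero
pattern i1 = suc zero
pattern i2 = suc (suc zero)
pattern i3 = suc (suc (suc zero))

-- ℘₂(I₄): the six 2-element subsets of I₄, enumerated explicitly.
-- pᵢⱼ stands for the set {i,j}.

data ℘₂ : Set where
  p01 p02 p03 p12 p13 p23 : ℘₂

el₁ el₂ : ℘₂ → I₄
el₁ p01 = i0
el₁ p02 = i0
el₁ p03 = i0
el₁ p12 = i1
el₁ p13 = i1
el₁ p23 = i2
el₂ p01 = i1
el₂ p02 = i2
el₂ p03 = i3
el₂ p12 = i2
el₂ p13 = i3
el₂ p23 = i3

_∈₂_ : I₄ → ℘₂ → Set
i ∈₂ u = (i ≡ el₁ u) ⊎ (i ≡ el₂ u)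

⟪_,_⟫ : (i j : I₄) → i ≢ j → ℘₂
⟪ i0 , i0 ⟫ n = ⊥-elim (n refl)
⟪ i0 , i1 ⟫ _ = p01
⟪ i0 , i2 ⟫ _ = p02
⟪ i0 , i3 ⟫ _ = p03
⟪ i1 , i0 ⟫ _ = p01
⟪ i1 , i1 ⟫ n = ⊥-elim (n refl)
⟪ i1 , i2 ⟫ _ = p12
⟪ i1 , i3 ⟫ _ = p13
⟪ i2 , i0 ⟫ _ = p02
⟪ i2 , i1 ⟫ _ = p12
⟪ i2 , i2 ⟫ n = ⊥-elim (n refl)
⟪ i2 , i3 ⟫ _ = p23
⟪ i3 , i0 ⟫ _ = p03
⟪ i3 , i1 ⟫ _ = p13
⟪ i3 , i2 ⟫ _ = p23
⟪ i3 , i3 ⟫ n = ⊥-elim (n refl)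

el₁≢el₂ : (u : ℘₂) → el₁ u ≢ el₂ u
el₁≢el₂ p01 ()
el₁≢el₂ p02 ()
el₁≢el₂ p03 ()
el₁≢el₂ p12 ()
el₁≢el₂ p13 ()
el₁≢el₂ p23 ()

all℘₂ : List ℘₂
all℘₂ = p01 ∷ p02 ∷ p03 ∷ p12 ∷ p13 ∷ p23 ∷ []

allI₄ : List I₄
allI₄ = i0 ∷ i1 ∷ i2 ∷ i3 ∷ []

count : {A : Set} → (A → Bool) → List A → ℕ
count f []       = 0
count f (x ∷ xs) with f x
... | true  = sucℕ (count f xs)
... | false = count f xs

S₄ : Set
S₄ = Permutation′ 4

perm-injective : (ψ : S₄) {i j : I₄} → ψ ⟨$⟩ʳ i ≡ ψ ⟨$⟩ʳ j → i ≡ j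
perm-injective ψ {i} {j} e =
  trans (sym (inverseˡ ψ)) (trans (cong (ψ ⟨$⟩ˡ_) e) (inverseˡ ψ))

bar : S₄ → ℘₂ → ℘₂
bar ψ u = ⟪ ψ ⟨$⟩ʳ el₁ u , ψ ⟨$⟩ʳ el₂ u ⟫
            (λ e → el₁≢el₂ u (perm-injective ψ e))

-- ϰ(u) = I₄ ∖ u
ϰ : ℘₂ → ℘₂
ϰ p01 = p23
ϰ p02 = p13
ϰ p03 = p12
ϰ p12 = p03
ϰ p13 = p02
ϰ p23 = p01

-- the conjugate α φ α⁻¹, i.e.  i ↦ α (φ (α⁻¹ i))
-- (_∘ₚ_ is diagrammatic: (π ∘ₚ ρ) ⟨$⟩ʳ i = ρ ⟨$⟩ʳ (π ⟨$⟩ʳ i))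
conj : S₄ → S₄ → S₄
conj α φ = flip α ∘ₚ (φ ∘ₚ α)

record Veblen : Set where
  field
    inc        : Fin 4 → ℘₂ → Bool
    line-size  : ∀ k → count (inc k) all℘₂ ≡ 3
    point-deg  : ∀ u → count (λ k → inc k u) allI₄ ≡ 2
    meet-one   : ∀ k l → k ≢ l →
                 count (λ u → inc k u ∧ inc l u) all℘₂ ≡ 1

Config : Set₁
Config = Fin 4 → ℘₂ → Set

lines : Veblen → Config
lines 𝔑 k u = T (Veblen.inc 𝔑 k u)

barConf : S₄ → Veblen → Config
barConf α 𝔑 k v = Σ ℘₂ λ u → T (Veblen.inc 𝔑 k u) × (bar α u ≡ v)

data Point : Set where
  p : Point
  a : I₄ → Point
  b : I₄ → Point
  c : ℘₂ → Point

data Line : Set where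
  lN : Fin 4 → Line
  la : ℘₂ → Line
  lb : ℘₂ → Line
  lp : I₄ → Line

-- incidence of Π(p, δ, 𝔑); c_w ∈ lb u  iff  w = δ⁻¹(u)  iff  δ(w) = u
-- (δ is a bijection)
Π-inc : (δ : ℘₂ → ℘₂) → Config → Point → Line → Set
Π-inc δ N (c u) (lN k) = N k u
Π-inc δ N (a i) (la u) = i ∈₂ u
Π-inc δ N (c w) (la u) = w ≡ u
Π-inc δ N (b i) (lb u) = i ∈₂ u
Π-inc δ N (c w) (lb u) = δ w ≡ u
Π-inc δ N p     (lp i) = ⊤
Π-inc δ N (a j) (lp i) = j ≡ i
Π-inc δ N (b j) (lp i) = j ≡ i
Π-inc δ N _     _      = ⊥

-- Isomorphism of two incidence structures on the point set Point with
-- line labels Line (in each, distinct labels give distinct point sets):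
-- a bijection of points and a bijection of lines preserving and
-- reflecting incidence; equivalently, a bijection of the points mapping
-- lines onto lines.
record _≅_ (I₁ I₂ : Point → Line → Set) : Set where
  field
    onPoints : Point ↔ Point
    onLines  : Line ↔ Line
    preserves : ∀ x l → I₁ x l → I₂ (Inverse.to onPoints x) (Inverse.to onLines l)
    reflects  : ∀ x l → I₂ (Inverse.to onPoints x) (Inverse.to onLines l) → I₁ x l

module Submission where

-- Conjugating by α is a relabelling of Π: a_i ↦ a_{α i}, b_i ↦ b_{α i},
-- c_u ↦ c_{ᾱ u}.  Since ᾱ preserves membership it commutes with ϰ, and
-- ᾱ ∘ φ̄ = (αφα⁻¹)‾ ∘ ᾱ; so the lines {b_i, b_j, c_{δ⁻¹{i,j}}} for
-- δ = φ̄ϰ go to those for δ = (αφα⁻¹)‾ϰ, and the lines of 𝔑 to those of ᾱ(𝔑).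

open import Defs
open import Function using (_∘_)
open import Function.Bundles using (_↔_; Inverse; Injection; mk↔ₛ′)
open import Function.Properties.Inverse using (↔⇒↣)
open import Data.Fin.Permutation using (_⟨$⟩ʳ_; _⟨$⟩ˡ_; inverseˡ; flip)
open import Data.Product using (_×_; _,_)
open import Data.Sum using (_⊎_; inj₁; inj₂; swap) renaming (map to ⊎-map)
open import Data.Empty using (⊥-elim)
open import Data.Unit using (tt)
open import Relation.Nullary using (¬_)
open import Relation.Binary.PropositionalEquality
  using (_≡_; _≢_; refl; sym; trans; cong; subst; module ≡-Reasoning)

⟪x,y⟫-elements : ∀ x y (x≢y : x ≢ y) →
  (el₁ (⟪ x , y ⟫ x≢y) ≡ x × el₂ (⟪ x , y ⟫ x≢y) ≡ y) ⊎
  (el₁ (⟪ x , y ⟫ x≢y) ≡ y × el₂ (⟪ x , y ⟫ x≢y) ≡ x)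
⟪x,y⟫-elements i0 i0 x≢y = ⊥-elim (x≢y refl)
⟪x,y⟫-elements i0 i1 _   = inj₁ (refl , refl)
⟪x,y⟫-elements i0 i2 _   = inj₁ (refl , refl)
⟪x,y⟫-elements i0 i3 _   = inj₁ (refl , refl)
⟪x,y⟫-elements i1 i0 _   = inj₂ (refl , refl)
⟪x,y⟫-elements i1 i1 x≢y = ⊥-elim (x≢y refl)
⟪x,y⟫-elements i1 i2 _   = inj₁ (refl , refl)
⟪x,y⟫-elements i1 i3 _   = inj₁ (refl , refl)
⟪x,y⟫-elements i2 i0 _   = inj₂ (refl , refl)
⟪x,y⟫-elements i2 i1 _   = inj₂ (refl , refl)
⟪x,y⟫-elements i2 i2 x≢y = ⊥-elim (x≢y refl)
⟪x,y⟫-elements i2 i3 _   = inj₁ (refl , refl)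
⟪x,y⟫-elements i3 i0 _   = inj₂ (refl , refl)
⟪x,y⟫-elements i3 i1 _   = inj₂ (refl , refl)
⟪x,y⟫-elements i3 i2 _   = inj₂ (refl , refl)
⟪x,y⟫-elements i3 i3 x≢y = ⊥-elim (x≢y refl)

∈⟪x,y⟫⁺ : ∀ x y (x≢y : x ≢ y) {j} → j ≡ x ⊎ j ≡ y → j ∈₂ ⟪ x , y ⟫ x≢y
∈⟪x,y⟫⁺ x y x≢y j≡x⊎j≡y with ⟪x,y⟫-elements x y x≢y
... | inj₁ (e₁ , e₂) = ⊎-map (λ j≡x → trans j≡x (sym e₁)) (λ j≡y → trans j≡y (sym e₂)) j≡x⊎j≡y
... | inj₂ (e₁ , e₂) = swap (⊎-map (λ j≡x → trans j≡x (sym e₂)) (λ j≡y → trans j≡y (sym e₁)) j≡x⊎j≡y)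

∈⟪x,y⟫⁻ : ∀ x y (x≢y : x ≢ y) {j} → j ∈₂ ⟪ x , y ⟫ x≢y → j ≡ x ⊎ j ≡ y
∈⟪x,y⟫⁻ x y x≢y j∈ with ⟪x,y⟫-elements x y x≢y
... | inj₁ (e₁ , e₂) = ⊎-map (λ j≡ → trans j≡ e₁) (λ j≡ → trans j≡ e₂) j∈
... | inj₂ (e₁ , e₂) = swap (⊎-map (λ j≡ → trans j≡ e₁) (λ j≡ → trans j≡ e₂) j∈)

⟪el₁,el₂⟫ : ∀ u (n : el₁ u ≢ el₂ u) → ⟪ el₁ u , el₂ u ⟫ n ≡ u
⟪el₁,el₂⟫ p01 _ = refl
⟪el₁,el₂⟫ p02 _ = refl
⟪el₁,el₂⟫ p03 _ = refl
⟪el₁,el₂⟫ p12 _ = refl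
⟪el₁,el₂⟫ p13 _ = refl
⟪el₁,el₂⟫ p23 _ = refl

⟪el₂,el₁⟫ : ∀ u (n : el₂ u ≢ el₁ u) → ⟪ el₂ u , el₁ u ⟫ n ≡ u
⟪el₂,el₁⟫ p01 _ = refl
⟪el₂,el₁⟫ p02 _ = refl
⟪el₂,el₁⟫ p03 _ = refl
⟪el₂,el₁⟫ p12 _ = refl
⟪el₂,el₁⟫ p13 _ = refl
⟪el₂,el₁⟫ p23 _ = refl

≡⟪x,y⟫ : ∀ {x y} u → x ∈₂ u → y ∈₂ u → (x≢y : x ≢ y) → u ≡ ⟪ x , y ⟫ x≢y
≡⟪x,y⟫ u (inj₁ refl) (inj₁ refl) x≢y = ⊥-elim (x≢y refl)
≡⟪x,y⟫ u (inj₁ refl) (inj₂ refl) x≢y = sym (⟪el₁,el₂⟫ u x≢y)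
≡⟪x,y⟫ u (inj₂ refl) (inj₁ refl) x≢y = sym (⟪el₂,el₁⟫ u x≢y)
≡⟪x,y⟫ u (inj₂ refl) (inj₂ refl) x≢y = ⊥-elim (x≢y refl)

ϰ-disjoint : ∀ u {i} → i ∈₂ ϰ u → ¬ i ∈₂ u
ϰ-disjoint p01 (inj₁ refl) = λ { (inj₁ ()) ; (inj₂ ()) }
ϰ-disjoint p01 (inj₂ refl) = λ { (inj₁ ()) ; (inj₂ ()) }
ϰ-disjoint p02 (inj₁ refl) = λ { (inj₁ ()) ; (inj₂ ()) }
ϰ-disjoint p02 (inj₂ refl) = λ { (inj₁ ()) ; (inj₂ ()) }
ϰ-disjoint p03 (inj₁ refl) = λ { (inj₁ ()) ; (inj₂ ()) }
ϰ-disjoint p03 (inj₂ refl) = λ { (inj₁ ()) ; (inj₂ ()) }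
ϰ-disjoint p12 (inj₁ refl) = λ { (inj₁ ()) ; (inj₂ ()) }
ϰ-disjoint p12 (inj₂ refl) = λ { (inj₁ ()) ; (inj₂ ()) }
ϰ-disjoint p13 (inj₁ refl) = λ { (inj₁ ()) ; (inj₂ ()) }
ϰ-disjoint p13 (inj₂ refl) = λ { (inj₁ ()) ; (inj₂ ()) }
ϰ-disjoint p23 (inj₁ refl) = λ { (inj₁ ()) ; (inj₂ ()) }
ϰ-disjoint p23 (inj₂ refl) = λ { (inj₁ ()) ; (inj₂ ()) }

∉⇒∈ϰ : ∀ u i → ¬ i ∈₂ u → i ∈₂ ϰ u
∉⇒∈ϰ p01 i0 i∉ = ⊥-elim (i∉ (inj₁ refl))
∉⇒∈ϰ p01 i1 i∉ = ⊥-elim (i∉ (inj₂ refl))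
∉⇒∈ϰ p01 i2 _  = inj₁ refl
∉⇒∈ϰ p01 i3 _  = inj₂ refl
∉⇒∈ϰ p02 i0 i∉ = ⊥-elim (i∉ (inj₁ refl))
∉⇒∈ϰ p02 i1 _  = inj₁ refl
∉⇒∈ϰ p02 i2 i∉ = ⊥-elim (i∉ (inj₂ refl))
∉⇒∈ϰ p02 i3 _  = inj₂ refl
∉⇒∈ϰ p03 i0 i∉ = ⊥-elim (i∉ (inj₁ refl))
∉⇒∈ϰ p03 i1 _  = inj₁ refl
∉⇒∈ϰ p03 i2 _  = inj₂ refl
∉⇒∈ϰ p03 i3 i∉ = ⊥-elim (i∉ (inj₂ refl))
∉⇒∈ϰ p12 i0 _  = inj₁ refl
∉⇒∈ϰ p12 i1 i∉ = ⊥-elim (i∉ (inj₁ refl))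
∉⇒∈ϰ p12 i2 i∉ = ⊥-elim (i∉ (inj₂ refl))
∉⇒∈ϰ p12 i3 _  = inj₂ refl
∉⇒∈ϰ p13 i0 _  = inj₁ refl
∉⇒∈ϰ p13 i1 i∉ = ⊥-elim (i∉ (inj₁ refl))
∉⇒∈ϰ p13 i2 _  = inj₂ refl
∉⇒∈ϰ p13 i3 i∉ = ⊥-elim (i∉ (inj₂ refl))
∉⇒∈ϰ p23 i0 _  = inj₁ refl
∉⇒∈ϰ p23 i1 _  = inj₂ refl
∉⇒∈ϰ p23 i2 i∉ = ⊥-elim (i∉ (inj₁ refl))
∉⇒∈ϰ p23 i3 i∉ = ⊥-elim (i∉ (inj₂ refl))

module _ (ψ : S₄) where

  bar-∈ : ∀ {u i} → i ∈₂ u → (ψ ⟨$⟩ʳ i) ∈₂ bar ψ u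
  bar-∈ {u} i∈u = ∈⟪x,y⟫⁺ _ _ _ (⊎-map (cong (ψ ⟨$⟩ʳ_)) (cong (ψ ⟨$⟩ʳ_)) i∈u)

  ∈-bar⁻¹ : ∀ {u j} → j ∈₂ bar ψ u → (ψ ⟨$⟩ˡ j) ∈₂ u
  ∈-bar⁻¹ {u} j∈ = ⊎-map pull pull (∈⟪x,y⟫⁻ _ _ _ j∈)
    where
    pull : ∀ {j i} → j ≡ ψ ⟨$⟩ʳ i → ψ ⟨$⟩ˡ j ≡ i
    pull refl = inverseˡ ψ

  bar-∈⁻ : ∀ {u i} → (ψ ⟨$⟩ʳ i) ∈₂ bar ψ u → i ∈₂ u
  bar-∈⁻ {u} ψi∈ = subst (_∈₂ u) (inverseˡ ψ) (∈-bar⁻¹ ψi∈)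

  bar-≡ : ∀ {u v} → (∀ {i} → i ∈₂ u → (ψ ⟨$⟩ʳ i) ∈₂ v) → bar ψ u ≡ v
  bar-≡ {u} {v} ψ[u]⊆v = sym (≡⟪x,y⟫ v (ψ[u]⊆v (inj₁ refl)) (ψ[u]⊆v (inj₂ refl)) _)

  bar-ϰ : ∀ u → bar ψ (ϰ u) ≡ ϰ (bar ψ u)
  bar-ϰ u = bar-≡ λ i∈ϰu → ∉⇒∈ϰ _ _ (ϰ-disjoint u i∈ϰu ∘ bar-∈⁻)


bar-conj : ∀ α φ w → bar (conj α φ) (bar α w) ≡ bar α (bar φ w)
bar-conj α φ w = bar-≡ (conj α φ) (bar-∈ α ∘ bar-∈ φ ∘ ∈-bar⁻¹ α)

bar↔ : S₄ → ℘₂ ↔ ℘₂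
bar↔ ψ = mk↔ₛ′ (bar ψ) (bar (flip ψ)) (λ _ → bar-≡ ψ (∈-bar⁻¹ (flip ψ))) (λ _ → bar-≡ (flip ψ) (∈-bar⁻¹ ψ))

module Relabelling (σ : I₄ ↔ I₄) (τ : ℘₂ ↔ ℘₂)
  (∈-preserved : ∀ {i u} → i ∈₂ u → Inverse.to σ i ∈₂ Inverse.to τ u)
  (∈-reflected : ∀ {i u} → Inverse.to σ i ∈₂ Inverse.to τ u → i ∈₂ u)
  where

  private
    module σ = Inverse σ
    module τ = Inverse τ

  relabelPoint : Point → Point
  relabelPoint p     = p
  relabelPoint (a i) = a (σ.to i)
  relabelPoint (b i) = b (σ.to i)
  relabelPoint (c u) = c (τ.to u)

  unrelabelPoint : Point → Point
  unrelabelPoint p     = p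
  unrelabelPoint (a i) = a (σ.from i)
  unrelabelPoint (b i) = b (σ.from i)
  unrelabelPoint (c u) = c (τ.from u)

  relabelLine : Line → Line
  relabelLine (lN k) = lN k
  relabelLine (la u) = la (τ.to u)
  relabelLine (lb u) = lb (τ.to u)
  relabelLine (lp i) = lp (σ.to i)

  unrelabelLine : Line → Line
  unrelabelLine (lN k) = lN k
  unrelabelLine (la u) = la (τ.from u)
  unrelabelLine (lb u) = lb (τ.from u)
  unrelabelLine (lp i) = lp (σ.from i)

  relabelPoint↔ : Point ↔ Point
  relabelPoint↔ = mk↔ₛ′ relabelPoint unrelabelPoint to∘from from∘to
    where
    to∘from : ∀ x → relabelPoint (unrelabelPoint x) ≡ x
    to∘from p     = refl
    to∘from (a i) = cong a (σ.strictlyInverseˡ i)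
    to∘from (b i) = cong b (σ.strictlyInverseˡ i)
    to∘from (c u) = cong c (τ.strictlyInverseˡ u)
    from∘to : ∀ x → unrelabelPoint (relabelPoint x) ≡ x
    from∘to p     = refl
    from∘to (a i) = cong a (σ.strictlyInverseʳ i)
    from∘to (b i) = cong b (σ.strictlyInverseʳ i)
    from∘to (c u) = cong c (τ.strictlyInverseʳ u)

  relabelLine↔ : Line ↔ Line
  relabelLine↔ = mk↔ₛ′ relabelLine unrelabelLine to∘from from∘to
    where
    to∘from : ∀ l → relabelLine (unrelabelLine l) ≡ l
    to∘from (lN k) = refl
    to∘from (la u) = cong la (τ.strictlyInverseˡ u)
    to∘from (lb u) = cong lb (τ.strictlyInverseˡ u)
    to∘from (lp i) = cong lp (σ.strictlyInverseˡ i)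
    from∘to : ∀ l → unrelabelLine (relabelLine l) ≡ l
    from∘to (lN k) = refl
    from∘to (la u) = cong la (τ.strictlyInverseʳ u)
    from∘to (lb u) = cong lb (τ.strictlyInverseʳ u)
    from∘to (lp i) = cong lp (σ.strictlyInverseʳ i)

  σ-injective : ∀ {i j} → σ.to i ≡ σ.to j → i ≡ j
  σ-injective = Injection.injective (↔⇒↣ σ)

  τ-injective : ∀ {u v} → τ.to u ≡ τ.to v → u ≡ v
  τ-injective = Injection.injective (↔⇒↣ τ)

  Π-inc-relabel : ∀ {δ δ' N N'} →
    (∀ w → δ' (τ.to w) ≡ τ.to (δ w)) →
    (∀ {k u} → N k u → N' k (τ.to u)) →
    (∀ {k u} → N' k (τ.to u) → N k u) →
    Π-inc δ N ≅ Π-inc δ' N'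
  Π-inc-relabel {δ} {δ'} {N} {N'} δ'∘τ≗τ∘δ N⇒N' N'⇒N = record
    { onPoints  = relabelPoint↔
    ; onLines   = relabelLine↔
    ; preserves = preserves
    ; reflects  = reflects
    }
    where
    preserves : ∀ x l → Π-inc δ N x l → Π-inc δ' N' (relabelPoint x) (relabelLine l)
    preserves (c u) (lN k) u∈L  = N⇒N' u∈L
    preserves (a i) (la u) i∈u  = ∈-preserved i∈u
    preserves (c w) (la u) w≡u  = cong τ.to w≡u
    preserves (b i) (lb u) i∈u  = ∈-preserved i∈u
    preserves (c w) (lb u) δw≡u = trans (δ'∘τ≗τ∘δ w) (cong τ.to δw≡u)
    preserves p     (lp i) _    = tt
    preserves (a j) (lp i) j≡i  = cong σ.to j≡i
    preserves (b j) (lp i) j≡i  = cong σ.to j≡i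
    preserves p     (lN _) ()
    preserves p     (la _) ()
    preserves p     (lb _) ()
    preserves (a _) (lN _) ()
    preserves (a _) (lb _) ()
    preserves (b _) (lN _) ()
    preserves (b _) (la _) ()
    preserves (c _) (lp _) ()

    reflects : ∀ x l → Π-inc δ' N' (relabelPoint x) (relabelLine l) → Π-inc δ N x l
    reflects (c u) (lN k) τu∈L    = N'⇒N τu∈L
    reflects (a i) (la u) σi∈τu   = ∈-reflected σi∈τu
    reflects (c w) (la u) τw≡τu   = τ-injective τw≡τu
    reflects (b i) (lb u) σi∈τu   = ∈-reflected σi∈τu
    reflects (c w) (lb u) δ'τw≡τu = τ-injective (trans (sym (δ'∘τ≗τ∘δ w)) δ'τw≡τu)
    reflects p     (lp i) _       = tt
    reflects (a j) (lp i) σj≡σi   = σ-injective σj≡σi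
    reflects (b j) (lp i) σj≡σi   = σ-injective σj≡σi
    reflects p     (lN _) ()
    reflects p     (la _) ()
    reflects p     (lb _) ()
    reflects (a _) (lN _) ()
    reflects (a _) (lb _) ()
    reflects (b _) (lN _) ()
    reflects (b _) (la _) ()
    reflects (c _) (lp _) ()

bar-conj-ϰ : ∀ α φ w → bar (conj α φ) (ϰ (bar α w)) ≡ bar α (bar φ (ϰ w))
bar-conj-ϰ α φ w = begin
  bar (conj α φ) (ϰ (bar α w))   ≡⟨ cong (bar (conj α φ)) (bar-ϰ α w) ⟨
  bar (conj α φ) (bar α (ϰ w))   ≡⟨ bar-conj α φ (ϰ w) ⟩
  bar α (bar φ (ϰ w))            ∎
  where open ≡-Reasoning

corollary4p6 : (φ α : S₄) (𝔑 : Veblen) →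
    Π-inc (bar φ ∘ ϰ) (lines 𝔑) ≅ Π-inc (bar (conj α φ) ∘ ϰ) (barConf α 𝔑)
corollary4p6 φ α 𝔑 = Π-inc-relabel (bar-conj-ϰ α φ) lines⇒barConf barConf⇒lines
  where
  open Relabelling α (bar↔ α) (bar-∈ α) (bar-∈⁻ α)

  lines⇒barConf : ∀ {k u} → lines 𝔑 k u → barConf α 𝔑 k (bar α u)
  lines⇒barConf {u = u} u∈L = u , u∈L , refl

  barConf⇒lines : ∀ {k u} → barConf α 𝔑 k (bar α u) → lines 𝔑 k u
  barConf⇒lines {k} (w , w∈L , ᾱw≡ᾱu) = subst (lines 𝔑 k) (τ-injective ᾱw≡ᾱu) w∈L
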